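{- Let $n\ge 1$, let $\mathbf m=(m_1,\dots,m_n)$ and $\mathbf M=(M_1,\dots,M_n)$ be vectors of $\mathbb R^n$ with components arranged in nonincreasing order, $0\le m_i\le M_i$ for all $i$, and assume moreover $M_{i+1}<m_i$ for $i=1,\dots,n-1$. Let $a>0$ with $\sum_{i=1}^n m_i\le a\le\sum_{i=1}^n M_i$, and let $$S_a=\Big\{\mathbf x\in\mathbb R^n:\ x_1\ge\dots\ge x_n\ge 0,\ \sum_{i=1}^n x_i=a,\ m_i\le x_i\le M_i \text{ for } i=1,\dots,n\Big\}.$$ Let $k\ge0$ be the smallest integer such that $$\sum_{i=1}^{k+1}m_i+\sum_{i=k+2}^n M_i\ \le\ a\ <\ \sum_{i=1}^{k}m_i+\sum_{i=k+1}^n M_i,$$ and let $\rho=a-\sum_{i=1}^k m_i-\sum_{i=k+2}^n M_i$. Then the minimal element of $S_a$ with respect to the majorization order is $$\mathbf x_*(S_a)=(m_1,\dots,m_k,\ \rho,\ M_{k+2},\dots,M_n).$$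
   Context: For vectors $\mathbf x,\mathbf y\in\mathbb R^n$ with components arranged in nonincreasing order, $\mathbf x\trianglelefteq\mathbf y$ (majorization) means $\sum_{i=1}^j x_i\le\sum_{i=1}^j y_i$ for $j=1,\dots,n-1$ and $\sum_{i=1}^n x_i=\sum_{i=1}^n y_i$. The minimal element $\mathbf x_*(S)$ of a set $S$ is the element of $S$ with $\mathbf x_*(S)\trianglelefteq\mathbf x$ for all $\mathbf x\in S$. Empty sums are $0$. -}

module Defs where

-- The paper works in ℝ. The standard library has no real numbers, so we state
-- the result for an arbitrary ordered field (ℝ being one instance).  The
-- argument only uses the ordered additive structure.

open import Level using (Level; _⊔_) renaming (suc to lsuc)
open import Data.Nat as ℕ using (ℕ; zero; suc; _<ᵇ_; _≤ᵇ_; _≡ᵇ_)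
open import Data.Bool using (Bool; true; false; if_then_else_; _∧_)
open import Data.Fin as Fin using (Fin; toℕ)
open import Data.Product using (Σ; _×_)
open import Relation.Nullary using (¬_)
open import Algebra.Bundles using (CommutativeRing)
open import Relation.Binary.Structures using (IsTotalOrder)

record OrderedField (c ℓ : Level) : Set (lsuc (c ⊔ ℓ)) where
  field
    commutativeRing : CommutativeRing c ℓ
  open CommutativeRing commutativeRing public
  field
    _≤_          : Carrier → Carrier → Set ℓ
    isTotalOrder : IsTotalOrder _≈_ _≤_
    +-monoˡ-≤    : ∀ {x y} z → x ≤ y → (x + z) ≤ (y + z)
    *-nonneg     : ∀ {x y} → 0# ≤ x → 0# ≤ y → 0# ≤ (x * y)
    0≉1          : ¬ (0# ≈ 1#)
    inverse      : ∀ x → ¬ (x ≈ 0#) → Σ Carrier (λ y → (x * y) ≈ 1#)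

  _<_ : Carrier → Carrier → Set ℓ
  x < y = (x ≤ y) × ¬ (x ≈ y)

  infix 4 _≤_ _<_

module OF {c ℓ : Level} (F : OrderedField c ℓ) where
  open OrderedField F public

  sumF : ∀ {n} → (Fin n → Carrier) → Carrier
  sumF {zero}  f = 0#
  sumF {suc n} f = f Fin.zero + sumF (λ i → f (Fin.suc i))

  -- sumRange lo hi x  =  Σ_{i = lo+1}^{hi} x_i  (1-based indices; the 0-based
  -- index i : Fin n contributes iff lo ≤ toℕ i < hi).  Empty sums are 0.
  sumRange : ∀ {n} → ℕ → ℕ → (Fin n → Carrier) → Carrier
  sumRange lo hi x = sumF (λ i → if (lo ≤ᵇ toℕ i) ∧ (toℕ i <ᵇ hi) then x i else 0#)

  Nonincreasing : ∀ {n} → (Fin n → Carrier) → Set ℓ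
  Nonincreasing x = ∀ i j → i Fin.≤ j → x j ≤ x i

  -- majorization  x ⊴ y  (for vectors with nonincreasing components)
  _⊴_ : ∀ {n} → (Fin n → Carrier) → (Fin n → Carrier) → Set ℓ
  _⊴_ {n} x y =
    (∀ j → 1 ℕ.≤ j → j ℕ.< n → sumRange 0 j x ≤ sumRange 0 j y)
    × (sumRange 0 n x ≈ sumRange 0 n y)

  S : ∀ {n} → (m M : Fin n → Carrier) → (a : Carrier) → (Fin n → Carrier) → Set ℓ
  S {n} m M a x =
    Nonincreasing x
    × (∀ i → 0# ≤ x i)
    × (sumRange 0 n x ≈ a)
    × (∀ i → (m i ≤ x i) × (x i ≤ M i))

  IsMinimalElement : ∀ {n} → ((Fin n → Carrier) → Set ℓ) → (Fin n → Carrier) → Set (c ⊔ ℓ)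
  IsMinimalElement P v = P v × (∀ x → P x → v ⊴ x)

  KCond : ∀ {n} → (m M : Fin n → Carrier) → (a : Carrier) → ℕ → Set ℓ
  KCond {n} m M a k =
    ((sumRange 0 (suc k) m + sumRange (suc k) n M) ≤ a)
    × (a < (sumRange 0 k m + sumRange k n M))

  ρ : ∀ {n} → (m M : Fin n → Carrier) → (a : Carrier) → ℕ → Carrier
  ρ {n} m M a k = (a - sumRange 0 k m) - sumRange (suc k) n M

  -- (m_1,…,m_k, ρ, M_{k+2},…,M_n)  (0-based index i ↔ 1-based i+1)
  xStar : ∀ {n} → (m M : Fin n → Carrier) → (a : Carrier) → ℕ → Fin n → Carrier
  xStar m M a k i =
    if toℕ i <ᵇ k then m i
    else (if toℕ i ≡ᵇ k then ρ m M a k else M i)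

module Submission where

open import Defs
open import Level using (Level)
open import Data.Nat as ℕ using (ℕ; suc)
open import Data.Fin as Fin using (Fin; toℕ)
open import Data.Product using (_×_)
open import Relation.Nullary using (¬_)
open import Relation.Binary.PropositionalEquality using (_≡_)

open import Data.Nat using (zero; _≤ᵇ_; _<ᵇ_; z≤n)
import Data.Nat.Properties as ℕP
import Data.Fin.Properties as FinP
open import Data.Bool using (Bool; true; false; if_then_else_; _∧_)
open import Data.Bool.Properties using (∧-zeroʳ; if-cong)
open import Data.Product using (_,_; proj₁; proj₂)
open import Data.Sum using (inj₁; inj₂)
open import Relation.Binary.Definitions using (tri<; tri≈; tri>)
open import Data.Empty using (⊥-elim)
open import Relation.Nullary using (yes; no)
open import Relation.Nullary.Decidable using (dec-true; dec-false)
import Relation.Binary.PropositionalEquality as ≡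
open import Relation.Binary.Bundles using (Poset)
open import Relation.Binary.Structures using (IsTotalOrder)

-- Write A = m₁+…+m_k and B = M_{k+2}+…+M_n, so that
-- ρ = a − A − B and x* = (m₁,…,m_k, ρ, M_{k+2},…,M_n).
--  * The two inequalities defining k say exactly m_{k+1} ≤ ρ ≤ M_{k+1}; they
--    also force k < n, since for k ≥ n both bounds collapse to Σ m.
--  * Hence m ≤ x* ≤ M componentwise and x* sums to a.  Separation
--    (M_{i+1} < m_i) makes every vector squeezed between m and M
--    nonincreasing, so x* ∈ S_a.
--  * Minimality: for x ∈ S_a and a prefix length j ≤ k, the prefix of x* is
--    the prefix of m, below that of x; for j > k the tail of x* is the tail
--    of M, above that of x, while both totals equal a.

inRange : ℕ → ℕ → ℕ → Bool
inRange lo hi t = (lo ≤ᵇ t) ∧ (t <ᵇ hi)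

inRange-inside : ∀ {lo hi t} → lo ℕ.≤ t → t ℕ.< hi → inRange lo hi t ≡ true
inRange-inside {lo} {hi} {t} lo≤t t<hi =
  ≡.cong₂ _∧_ (dec-true (lo ℕ.≤? t) lo≤t) (dec-true (t ℕ.<? hi) t<hi)

inRange-below : ∀ {lo hi t} → t ℕ.< lo → inRange lo hi t ≡ false
inRange-below {lo} {hi} {t} t<lo = ≡.cong (_∧ (t <ᵇ hi)) (dec-false (lo ℕ.≤? t) (ℕP.<⇒≱ t<lo))

inRange-above : ∀ {lo hi t} → hi ℕ.≤ t → inRange lo hi t ≡ false
inRange-above {lo} {hi} {t} hi≤t =
  ≡.trans (≡.cong ((lo ≤ᵇ t) ∧_) (dec-false (t ℕ.<? hi) (ℕP.≤⇒≯ hi≤t))) (∧-zeroʳ _)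

inRange-left : ∀ lo {mid hi t} → t ℕ.< mid → mid ℕ.≤ hi → inRange lo hi t ≡ inRange lo mid t
inRange-left lo {mid} {hi} {t} t<mid mid≤hi = ≡.cong ((lo ≤ᵇ t) ∧_)
  (≡.trans (dec-true (t ℕ.<? hi) (ℕP.<-≤-trans t<mid mid≤hi)) (≡.sym (dec-true (t ℕ.<? mid) t<mid)))

inRange-right : ∀ hi {lo mid t} → mid ℕ.≤ t → lo ℕ.≤ mid → inRange lo hi t ≡ inRange mid hi t
inRange-right hi {lo} {mid} {t} mid≤t lo≤mid = ≡.cong (_∧ (t <ᵇ hi))
  (≡.trans (dec-true (lo ℕ.≤? t) (ℕP.≤-trans lo≤mid mid≤t)) (≡.sym (dec-true (mid ℕ.≤? t) mid≤t)))

data RangeCase (lo hi t : ℕ) : Set where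
  inside  : lo ℕ.≤ t → t ℕ.< hi → inRange lo hi t ≡ true → RangeCase lo hi t
  outside : inRange lo hi t ≡ false → RangeCase lo hi t

rangeCase : ∀ lo hi t → RangeCase lo hi t
rangeCase lo hi t with lo ℕ.≤? t | t ℕ.<? hi
... | yes lo≤t | yes t<hi = inside lo≤t t<hi (inRange-inside lo≤t t<hi)
... | yes _    | no t≮hi  = outside (inRange-above {lo} (ℕP.≮⇒≥ t≮hi))
... | no lo≰t  | _        = outside (inRange-below {hi = hi} (ℕP.≰⇒> lo≰t))

module Theory {c ℓ : Level} (F : OrderedField c ℓ) where
  open OF F
  open IsTotalOrder isTotalOrder using (antisym)
    renaming (refl to ≤-refl; trans to ≤-trans)

  poset : Poset c ℓ ℓ
  poset = record { isPartialOrder = IsTotalOrder.isPartialOrder isTotalOrder }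

  open import Relation.Binary.Reasoning.PartialOrder poset
  open import Algebra.Properties.CommutativeSemigroup +-commutativeSemigroup
    using (interchange; xy∙z≈zx∙y)

  ≡⇒≈ : ∀ {x y} → x ≡ y → x ≈ y
  ≡⇒≈ ≡.refl = refl

  +-monoʳ-≤ : ∀ z {x y} → x ≤ y → z + x ≤ z + y
  +-monoʳ-≤ z {x} {y} x≤y = begin
    z + x  ≈⟨ +-comm z x ⟩
    x + z  ≤⟨ +-monoˡ-≤ z x≤y ⟩
    y + z  ≈⟨ +-comm y z ⟩
    z + y  ∎

  x+y-y≈x : ∀ x y → (x + y) - y ≈ x
  x+y-y≈x x y = trans (+-assoc x y (- y)) (trans (+-cong refl (-‿inverseʳ y)) (+-identityʳ x))

  x-y+y≈x : ∀ x y → (x - y) + y ≈ x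
  x-y+y≈x x y = trans (+-assoc x (- y) y) (trans (+-cong refl (-‿inverseˡ y)) (+-identityʳ x))

  +-cancelʳ-≤ : ∀ z {x y} → x + z ≤ y + z → x ≤ y
  +-cancelʳ-≤ z {x} {y} h = begin
    x            ≈⟨ x+y-y≈x x z ⟨
    (x + z) - z  ≤⟨ +-monoˡ-≤ (- z) h ⟩
    (y + z) - z  ≈⟨ x+y-y≈x y z ⟩
    y            ∎

  ≤-sub : ∀ {x y z} → x + z ≤ y → x ≤ y - z
  ≤-sub {x} {y} {z} h = begin
    x            ≈⟨ x+y-y≈x x z ⟨
    (x + z) - z  ≤⟨ +-monoˡ-≤ (- z) h ⟩
    y - z        ∎

  sub-≤ : ∀ {x y z} → y ≤ x + z → y - z ≤ x
  sub-≤ {x} {y} {z} h = begin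
    y - z        ≤⟨ +-monoˡ-≤ (- z) h ⟩
    (x + z) - z  ≈⟨ x+y-y≈x x z ⟩
    x            ∎

  head-from-tail : ∀ {a p q p′ q′} → p + q ≈ a → p′ + q′ ≈ a → q′ ≤ q → p ≤ p′
  head-from-tail {a} {p} {q} {p′} {q′} pq≈a p′q′≈a q′≤q = +-cancelʳ-≤ q (begin
    p + q    ≈⟨ trans pq≈a (sym p′q′≈a) ⟩
    p′ + q′  ≤⟨ +-monoʳ-≤ p′ q′≤q ⟩
    p′ + q   ∎)

  sumF-cong : ∀ {n} {f g : Fin n → Carrier} → (∀ i → f i ≈ g i) → sumF f ≈ sumF g
  sumF-cong {zero}  f≈g = refl
  sumF-cong {suc n} f≈g = +-cong (f≈g Fin.zero) (sumF-cong (λ i → f≈g (Fin.suc i)))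

  sumF-mono : ∀ {n} {f g : Fin n → Carrier} → (∀ i → f i ≤ g i) → sumF f ≤ sumF g
  sumF-mono {zero}  f≤g = ≤-refl
  sumF-mono {suc n} {f} {g} f≤g =
    ≤-trans (+-monoˡ-≤ _ (f≤g Fin.zero)) (+-monoʳ-≤ (g Fin.zero) (sumF-mono (λ i → f≤g (Fin.suc i))))

  sumF-zero : ∀ {n} {f : Fin n → Carrier} → (∀ i → f i ≈ 0#) → sumF f ≈ 0#
  sumF-zero {zero}  f≈0 = refl
  sumF-zero {suc n} f≈0 = trans (+-cong (f≈0 Fin.zero) (sumF-zero (λ i → f≈0 (Fin.suc i)))) (+-identityʳ 0#)

  sumF-+ : ∀ {n} (f g : Fin n → Carrier) → sumF (λ i → f i + g i) ≈ sumF f + sumF g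
  sumF-+ {zero}  f g = sym (+-identityʳ 0#)
  sumF-+ {suc n} f g =
    trans (+-cong refl (sumF-+ (λ i → f (Fin.suc i)) (λ i → g (Fin.suc i)))) (interchange _ _ _ _)

  sumF-concentrated : ∀ {n} (f : Fin n → Carrier) (i : Fin n) →
                      (∀ j → ¬ j ≡ i → f j ≈ 0#) → sumF f ≈ f i
  sumF-concentrated {suc n} f Fin.zero f≈0 =
    trans (+-cong refl (sumF-zero (λ j → f≈0 (Fin.suc j) (λ ())))) (+-identityʳ _)
  sumF-concentrated {suc n} f (Fin.suc i) f≈0 =
    trans (+-cong (f≈0 Fin.zero (λ ())) refl)
          (trans (+-identityˡ _)
                 (sumF-concentrated (λ j → f (Fin.suc j)) i
                   (λ j j≢i → f≈0 (Fin.suc j) (λ e → j≢i (FinP.suc-injective e)))))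

  guard : Bool → Carrier → Carrier
  guard b x = if b then x else 0#

  sumRange-cong : ∀ {n} lo hi {f g : Fin n → Carrier} →
                  (∀ i → lo ℕ.≤ toℕ i → toℕ i ℕ.< hi → f i ≈ g i) →
                  sumRange lo hi f ≈ sumRange lo hi g
  sumRange-cong lo hi {f} {g} f≈g = sumF-cong termwise
    where
    termwise : ∀ i → guard (inRange lo hi (toℕ i)) (f i) ≈ guard (inRange lo hi (toℕ i)) (g i)
    termwise i with rangeCase lo hi (toℕ i)
    ... | inside lo≤i i<hi e rewrite e = f≈g i lo≤i i<hi
    ... | outside e          rewrite e = refl

  sumRange-mono : ∀ {n} lo hi {f g : Fin n → Carrier} →
                  (∀ i → lo ℕ.≤ toℕ i → toℕ i ℕ.< hi → f i ≤ g i) →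
                  sumRange lo hi f ≤ sumRange lo hi g
  sumRange-mono lo hi {f} {g} f≤g = sumF-mono termwise
    where
    termwise : ∀ i → guard (inRange lo hi (toℕ i)) (f i) ≤ guard (inRange lo hi (toℕ i)) (g i)
    termwise i with rangeCase lo hi (toℕ i)
    ... | inside lo≤i i<hi e rewrite e = f≤g i lo≤i i<hi
    ... | outside e          rewrite e = ≤-refl

  sumRange-split : ∀ {n} {lo mid hi} (f : Fin n → Carrier) → lo ℕ.≤ mid → mid ℕ.≤ hi →
                   sumRange lo hi f ≈ sumRange lo mid f + sumRange mid hi f
  sumRange-split {lo = lo} {mid} {hi} f lo≤mid mid≤hi =
    trans (sumF-cong termwise) (sumF-+ (λ i → guard (inRange lo mid (toℕ i)) (f i))
                                       (λ i → guard (inRange mid hi (toℕ i)) (f i)))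
    where
    termwise : ∀ i → guard (inRange lo hi (toℕ i)) (f i)
                     ≈ guard (inRange lo mid (toℕ i)) (f i) + guard (inRange mid hi (toℕ i)) (f i)
    termwise i with toℕ i ℕ.<? mid
    ... | yes i<mid rewrite inRange-left lo i<mid mid≤hi | inRange-below {mid} {hi} i<mid =
      sym (+-identityʳ _)
    ... | no i≮mid rewrite inRange-right hi (ℕP.≮⇒≥ i≮mid) lo≤mid | inRange-above {lo} (ℕP.≮⇒≥ i≮mid) =
      sym (+-identityˡ _)

  sumRange-single : ∀ {n} {k} (f : Fin n → Carrier) (i : Fin n) → toℕ i ≡ k →
                    sumRange k (suc k) f ≈ f i
  sumRange-single f i ≡.refl =
    trans (sumF-concentrated _ i vanishes)
          (≡⇒≈ (if-cong (inRange-inside (ℕP.≤-refl {toℕ i}) (ℕP.n<1+n (toℕ i)))))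
    where
    vanishes : ∀ j → ¬ j ≡ i → guard (inRange (toℕ i) (suc (toℕ i)) (toℕ j)) (f j) ≈ 0#
    vanishes j j≢i with rangeCase (toℕ i) (suc (toℕ i)) (toℕ j)
    ... | inside i≤j j<1+i _ = ⊥-elim (j≢i (FinP.toℕ-injective (ℕP.≤-antisym (ℕ.s≤s⁻¹ j<1+i) i≤j)))
    ... | outside e rewrite e = refl

  sumRange-snoc : ∀ {n} {lo k} (f : Fin n → Carrier) (i : Fin n) → toℕ i ≡ k → lo ℕ.≤ k →
                  sumRange lo (suc k) f ≈ sumRange lo k f + f i
  sumRange-snoc f i i≡k lo≤k =
    trans (sumRange-split f lo≤k (ℕP.n≤1+n _)) (+-cong refl (sumRange-single f i i≡k))

  sumRange-cons : ∀ {n} {k hi} (f : Fin n → Carrier) (i : Fin n) → toℕ i ≡ k → k ℕ.< hi →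
                  sumRange k hi f ≈ f i + sumRange (suc k) hi f
  sumRange-cons f i i≡k k<hi =
    trans (sumRange-split f (ℕP.n≤1+n _) k<hi) (+-cong (sumRange-single f i i≡k) refl)

  sumRange-truncate : ∀ {n} lo {hi} (f : Fin n → Carrier) → n ℕ.≤ hi → sumRange lo hi f ≈ sumRange lo n f
  sumRange-truncate lo f n≤hi =
    sumF-cong (λ i → ≡⇒≈ (if-cong (inRange-left lo (FinP.toℕ<n i) n≤hi)))

  sumRange-empty : ∀ {n} {lo} hi (f : Fin n → Carrier) → n ℕ.≤ lo → sumRange lo hi f ≈ 0#
  sumRange-empty hi f n≤lo =
    sumF-zero (λ i → ≡⇒≈ (if-cong (inRange-below {hi = hi} (ℕP.<-≤-trans (FinP.toℕ<n i) n≤lo))))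

  separation-gap : ∀ {n} {m M : Fin n → Carrier} → Nonincreasing M →
                   (∀ i j → toℕ j ≡ suc (toℕ i) → M j < m i) →
                   ∀ i j → toℕ i ℕ.< toℕ j → M j ≤ m i
  separation-gap {n} {m} {M} M↓ sep i j i<j = ≤-trans (M↓ i′ j i′≤j) (proj₁ (sep i i′ i′≡1+i))
    where
    i′ : Fin n
    i′ = Fin.fromℕ< (ℕP.≤-<-trans i<j (FinP.toℕ<n j))
    i′≡1+i : toℕ i′ ≡ suc (toℕ i)
    i′≡1+i = FinP.toℕ-fromℕ< _
    i′≤j : toℕ i′ ℕ.≤ toℕ j
    i′≤j = ≡.subst (ℕ._≤ toℕ j) (≡.sym i′≡1+i) i<j

  squeezed⇒nonincreasing : ∀ {n} {m M x : Fin n → Carrier} →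
                           (∀ i j → toℕ i ℕ.< toℕ j → M j ≤ m i) →
                           (∀ i → (m i ≤ x i) × (x i ≤ M i)) → Nonincreasing x
  squeezed⇒nonincreasing {m = m} {M} {x} gap between i j i≤j with ℕP.m≤n⇒m<n∨m≡n i≤j
  ... | inj₁ i<j = begin
    x j  ≤⟨ proj₂ (between j) ⟩
    M j  ≤⟨ gap i j i<j ⟩
    m i  ≤⟨ proj₁ (between i) ⟩
    x i  ∎
  ... | inj₂ i≡j rewrite FinP.toℕ-injective i≡j = ≤-refl

  -- The defining condition on k forces k < n: for k ≥ n both of its bounds
  -- equal Σ m, contradicting strictness.
  KCond⇒k<n : ∀ {n} {m M : Fin n → Carrier} {a} k → KCond m M a k → k ℕ.< n
  KCond⇒k<n {n} {m} {M} {a} k (lower≤a , a≤upper , a≉upper) with k ℕ.<? n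
  ... | yes k<n = k<n
  ... | no k≮n  = ⊥-elim (a≉upper (antisym a≤upper (begin
    sumRange 0 k m + sumRange k n M              ≈⟨ saturated k n≤k ⟩
    sumRange 0 n m                               ≈⟨ saturated (suc k) (ℕP.m≤n⇒m≤1+n n≤k) ⟨
    sumRange 0 (suc k) m + sumRange (suc k) n M  ≤⟨ lower≤a ⟩
    a                                            ∎)))
    where
    n≤k : n ℕ.≤ k
    n≤k = ℕP.≮⇒≥ k≮n
    saturated : ∀ j → n ℕ.≤ j → sumRange 0 j m + sumRange j n M ≈ sumRange 0 n m
    saturated j n≤j =
      trans (+-cong (sumRange-truncate 0 m n≤j) (sumRange-empty n M n≤j)) (+-identityʳ _)

  module Candidate {n} (m M : Fin n → Carrier)
                   (bounds : ∀ i → (0# ≤ m i) × (m i ≤ M i))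
                   (gap : ∀ i j → toℕ i ℕ.< toℕ j → M j ≤ m i)
                   (a : Carrier) (k : ℕ) (kc : KCond m M a k) where
    k<n : k ℕ.< n
    k<n = KCond⇒k<n k kc

    A B r : Carrier
    A = sumRange 0 k m
    B = sumRange (suc k) n M
    r = ρ m M a k

    x* : Fin n → Carrier
    x* = xStar m M a k

    xStar-below : ∀ i → toℕ i ℕ.< k → x* i ≡ m i
    xStar-below i i<k = if-cong (dec-true (toℕ i ℕ.<? k) i<k)

    xStar-at : ∀ i → toℕ i ≡ k → x* i ≡ r
    xStar-at i i≡k = ≡.trans (if-cong (dec-false (toℕ i ℕ.<? k) (ℕP.<-irrefl i≡k)))
                             (if-cong (dec-true (toℕ i ℕ.≟ k) i≡k))

    xStar-above : ∀ i → k ℕ.< toℕ i → x* i ≡ M i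
    xStar-above i k<i = ≡.trans (if-cong (dec-false (toℕ i ℕ.<? k) (ℕP.<-asym k<i)))
                                (if-cong (dec-false (toℕ i ℕ.≟ k) (ℕP.>⇒≢ k<i)))

    ρ-lower : ∀ i → toℕ i ≡ k → m i ≤ r
    ρ-lower i i≡k = ≤-sub (≤-sub (begin
      (m i + B) + A             ≈⟨ xy∙z≈zx∙y (m i) B A ⟩
      (A + m i) + B             ≈⟨ +-cong (sumRange-snoc m i i≡k z≤n) refl ⟨
      sumRange 0 (suc k) m + B  ≤⟨ proj₁ kc ⟩
      a                         ∎))

    ρ-upper : ∀ i → toℕ i ≡ k → r ≤ M i
    ρ-upper i i≡k = sub-≤ (sub-≤ (begin
      a                    ≤⟨ proj₁ (proj₂ kc) ⟩
      A + sumRange k n M   ≈⟨ +-cong refl (sumRange-cons M i i≡k k<n) ⟩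
      A + (M i + B)        ≈⟨ +-comm A (M i + B) ⟩
      (M i + B) + A        ∎))

    xStar-total : sumRange 0 n x* ≈ a
    xStar-total = begin-equality
      sumRange 0 n x*                                ≈⟨ sumRange-split x* z≤n (ℕP.<⇒≤ k<n) ⟩
      sumRange 0 k x* + sumRange k n x*              ≈⟨ +-cong refl (sumRange-cons x* i₀ i₀≡k k<n) ⟩
      sumRange 0 k x* + (x* i₀ + sumRange (suc k) n x*)
        ≈⟨ +-cong prefix (+-cong (≡⇒≈ (xStar-at i₀ i₀≡k)) suffix) ⟩
      A + (r + B)                                    ≈⟨ +-cong refl (x-y+y≈x (a - A) B) ⟩
      A + (a - A)                                    ≈⟨ +-comm A (a - A) ⟩
      (a - A) + A                                    ≈⟨ x-y+y≈x a A ⟩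
      a                                              ∎
      where
      i₀ : Fin n
      i₀ = Fin.fromℕ< k<n
      i₀≡k : toℕ i₀ ≡ k
      i₀≡k = FinP.toℕ-fromℕ< k<n
      prefix : sumRange 0 k x* ≈ A
      prefix = sumRange-cong 0 k (λ i _ i<k → ≡⇒≈ (xStar-below i i<k))
      suffix : sumRange (suc k) n x* ≈ B
      suffix = sumRange-cong (suc k) n (λ i k<i _ → ≡⇒≈ (xStar-above i k<i))

    xStar-between : ∀ i → (m i ≤ x* i) × (x* i ≤ M i)
    xStar-between i with ℕP.<-cmp (toℕ i) k
    ... | tri< i<k _ _ rewrite xStar-below i i<k = ≤-refl , proj₂ (bounds i)
    ... | tri≈ _ i≡k _ rewrite xStar-at i i≡k = ρ-lower i i≡k , ρ-upper i i≡k
    ... | tri> _ _ k<i rewrite xStar-above i k<i = proj₂ (bounds i) , ≤-refl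

    xStar∈S : S m M a x*
    xStar∈S = squeezed⇒nonincreasing gap xStar-between
            , (λ i → ≤-trans (proj₁ (bounds i)) (proj₁ (xStar-between i)))
            , xStar-total
            , xStar-between

    xStar-prefix : ∀ x → S m M a x → ∀ j → j ℕ.< n → sumRange 0 j x* ≤ sumRange 0 j x
    xStar-prefix x (_ , _ , x-total , x-between) j j<n with j ℕ.≤? k
    ... | yes j≤k = sumRange-mono 0 j λ i _ i<j →
      ≡.subst (_≤ x i) (≡.sym (xStar-below i (ℕP.<-≤-trans i<j j≤k))) (proj₁ (x-between i))
    ... | no j≰k = head-from-tail (decompose x* xStar-total) (decompose x x-total)
                                  (sumRange-mono j n λ i j≤i _ →
                                    ≡.subst (x i ≤_) (≡.sym (xStar-above i (ℕP.<-≤-trans (ℕP.≰⇒> j≰k) j≤i)))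
                                            (proj₂ (x-between i)))
      where
      decompose : ∀ y → sumRange 0 n y ≈ a → sumRange 0 j y + sumRange j n y ≈ a
      decompose y total = trans (sym (sumRange-split y z≤n (ℕP.<⇒≤ j<n))) total

    xStar-minimal : IsMinimalElement (S m M a) x*
    xStar-minimal = xStar∈S , λ x x∈S → (λ j _ j<n → xStar-prefix x x∈S j j<n)
                                      , trans xStar-total (sym (proj₁ (proj₂ (proj₂ x∈S))))

corollary9 : ∀ {c ℓ : Level} (F : OrderedField c ℓ) → let open OF F in
    ∀ (n : ℕ) → 1 ℕ.≤ n →
    ∀ (m M : Fin n → Carrier) →
    Nonincreasing m → Nonincreasing M →
    (∀ i → (0# ≤ m i) × (m i ≤ M i)) →
    (∀ (i j : Fin n) → toℕ j ≡ suc (toℕ i) → M j < m i) →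
    ∀ (a : Carrier) → 0# < a →
    sumRange 0 n m ≤ a → a ≤ sumRange 0 n M →
    ∀ (k : ℕ) → KCond m M a k → (∀ j → j ℕ.< k → ¬ KCond m M a j) →
    IsMinimalElement (S m M a) (xStar m M a k)
corollary9 F n _ m M _ M↓ bounds sep a _ _ _ k kc _ =
  Candidate.xStar-minimal m M bounds (separation-gap M↓ sep) a k kc
  where open Theory F
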